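{- Let $G=(V,T,\tau)$ be a temporal graph and let $\Delta=[t_s,t_e]\sqsubseteq T$, $\Delta'=[t_s-1,t_e]\sqsubseteq T$ and $\Delta''=[t_s,t_e+1]\sqsubseteq T$ be temporal intervals. Let $k^*$, $k'$, $k''$ be the orders of the innermost trusses of $G_\Delta$, $G_{\Delta'}$, $G_{\Delta''}$ respectively. Then the innermost truss $T_{k^*}[G_\Delta]$ is a maximal span-truss of $G$ if and only if $k^*>\max\{k',k''\}$.
   Context: A temporal graph is $G=(V,T,\tau)$ where $V$ is a finite vertex set, $T=[0,1,\dots,t_{max}]\subseteq\mathbb{N}$ is a discrete time domain, and $\tau:V\times V\times T\to\{0,1\}$ specifies whether the (undirected) edge $(u,v)$ exists at time $t$. For $t\in T$ let $E_t=\{(u,v):\tau(u,v,t)=1\}$. A temporal interval $\Delta=[t_s,t_e]$ is contained in $\Delta'=[t'_s,t'_e]$, written $\Delta\sqsubseteq\Delta'$, if $t'_s\le t_s$ and $t'_e\ge t_e$. For an interval $\Delta\sqsubseteq T$, $E_\Delta=\bigcap_{t\in\Delta}E_t$ and $G_\Delta=(V,E_\Delta)$. For a static graph $H$ and $k\ge2$, the $k$-truss of $H$ is the largest (edge-induced) subgraph of $H$ in which every edge lies in at least $k-2$ triangles of that subgraph; the innermost truss $T_{k^*}[H]$ is the non-empty $k$-truss of $H$ with the largest $k$, and $k^*$ is its order. The $(k,\Delta)$-truss (span-truss) $T_{k,\Delta}$ of $G$ is the $k$-truss of $G_\Delta$. A span-truss $T_{k,\Delta}$ is maximal if there is no other span-truss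 $T_{k',\Delta'}$ of $G$ with $k\le k'$ and $\Delta\sqsubseteq\Delta'$. -}

module Defs where

open import Data.Nat using (ℕ; zero; suc; _+_; _∸_; _≤_; _<_; _⊔_)
open import Data.Fin using (Fin)
open import Data.Bool using (Bool; true; false; T)
open import Data.List using (List; applyUpTo)
open import Data.Bool.ListAction using (all)
open import Data.Product using (Σ; ∃; _×_; _,_)
open import Function.Definitions using (Injective)
open import Relation.Binary.PropositionalEquality using (_≡_)
open import Relation.Nullary using (¬_)

-- A temporal graph G = (V, T, τ) with V = Fin n and T = [0 .. tmax].
-- τ is given on all of ℕ; only its values at times t ≤ tmax are ever used
-- (all intervals considered are contained in T).
record TemporalGraph : Set where
  field
    n      : ℕ
    tmax   : ℕ
    τ      : Fin n → Fin n → ℕ → Bool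
    τ-sym  : ∀ u v t → τ u v t ≡ τ v u t
    τ-irr  : ∀ u t → τ u u t ≡ false

open TemporalGraph public

Graph : ℕ → Set
Graph n = Fin n → Fin n → Bool

times : ℕ → ℕ → List ℕ
times ts te = applyUpTo (ts +_) (suc (te ∸ ts))

snap : (G : TemporalGraph) → ℕ → ℕ → Graph (n G)
snap G ts te u v = all (τ G u v) (times ts te)

_⊆ᴱ_ : ∀ {m} → Graph m → Graph m → Set
S ⊆ᴱ H = ∀ u v → T (S u v) → T (H u v)

Symmetric : ∀ {m} → Graph m → Set
Symmetric S = ∀ u v → S u v ≡ S v u

TrussCond : ∀ {m} → ℕ → Graph m → Set
TrussCond {m} k S =
  ∀ u v → T (S u v) →
    Σ (Fin (k ∸ 2) → Fin m) λ f →
      Injective _≡_ _≡_ f × (∀ i → T (S u (f i)) × T (S v (f i)))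

IsKTruss : ∀ {m} → Graph m → ℕ → Graph m → Set
IsKTruss {m} H k S =
  (S ⊆ᴱ H) × Symmetric S × TrussCond k S ×
  (∀ (S' : Graph m) → S' ⊆ᴱ H → Symmetric S' → TrussCond k S' → S' ⊆ᴱ S)

NonEmpty : ∀ {m} → Graph m → Set
NonEmpty S = ∃ λ u → ∃ λ v → T (S u v)

HasNonEmptyTruss : ∀ {m} → Graph m → ℕ → Set
HasNonEmptyTruss {m} H k = Σ (Graph m) λ S → IsKTruss H k S × NonEmpty S

IsInnermostOrder : ∀ {m} → Graph m → ℕ → Set
IsInnermostOrder H k =
  2 ≤ k × HasNonEmptyTruss H k × (∀ j → k < j → ¬ HasNonEmptyTruss H j)

ValidInterval : TemporalGraph → ℕ → ℕ → Set
ValidInterval G ts te = ts ≤ te × te ≤ tmax G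

_⊑_ : ℕ × ℕ → ℕ × ℕ → Set
(ts , te) ⊑ (ts' , te') = ts' ≤ ts × te ≤ te'

IsSpanTruss : (G : TemporalGraph) → ℕ → ℕ → ℕ → Set
IsSpanTruss G k ts te =
  2 ≤ k × ValidInterval G ts te × HasNonEmptyTruss (snap G ts te) k

IsMaximalSpanTruss : (G : TemporalGraph) → ℕ → ℕ → ℕ → Set
IsMaximalSpanTruss G k ts te =
  IsSpanTruss G k ts te ×
  (∀ k' ts' te' → k ≤ k' → (ts , te) ⊑ (ts' , te') →
     ¬ ((k' , ts' , te') ≡ (k , ts , te)) → ¬ IsSpanTruss G k' ts' te')

-- The k-truss of any graph H exists: starting from the symmetric part of H, repeatedly delete the
-- edges lying in fewer than k - 2 triangles. The edge count drops until nothing is deleted, and then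
-- every remaining edge satisfies the truss condition, while no edge of a truss-subgraph of H is ever
-- deleted. Hence a non-empty k-truss of a subgraph yields one of the supergraph; as snapshots shrink
-- when the interval grows, no interval containing [a, b] carries a non-empty truss of order above
-- the innermost order of G_[a,b]. Every interval strictly containing Δ contains Δ' or Δ'', so the
-- innermost truss of G_Δ is maximal exactly when k' and k'' are smaller than k*.
module Submission where

open import Defs
open import Data.Bool using (Bool; true; false; T; _∧_; if_then_else_)
open import Data.Bool.Properties using (T-∧; ∧-comm)
open import Data.Empty using (⊥-elim)
open import Data.Fin using (Fin; zero; suc; inject≤; combine; remQuot)
open import Data.Fin.Properties
  using (any?; injective⇒≤; inject≤-injective; suc-injective; remQuot-combine)
open import Data.List.Membership.Propositional using (_∈_)
open import Data.List.Membership.Propositional.Properties using (∈-applyUpTo⁺; ∈-applyUpTo⁻)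
open import Data.List.Relation.Binary.Subset.Propositional using (_⊆_)
open import Data.List.Relation.Unary.All.Properties using (all-anti-mono)
open import Data.Nat using (ℕ; zero; suc; _+_; _∸_; _≤_; _<_; _⊔_; _≤ᵇ_; z≤n; s≤s; s≤s⁻¹; z<s)
open import Data.Nat.GeneralisedArithmetic using (iterate)
open import Data.Nat.Properties
  using ( ≤-refl; ≤-reflexive; ≤-trans; ≤-antisym; <-≤-trans; ≰⇒>; ≤∧≢⇒<; <⇒≢; 1+n≢n
        ; m≤n⇒m≤1+n; n≤1+n; m≤n⇒m<n∨m≡n; ≤ᵇ⇒≤; ≤⇒≤ᵇ; m≤m+n; +-monoʳ-≤; m+[n∸m]≡n
        ; m∸n≤m; ∸-monoˡ-≤; ∸-monoʳ-<; ⊔-lub; m⊔n<o⇒m<o; m⊔n<o⇒n<o )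
open import Data.Product using (Σ; ∃; _×_; _,_; proj₁; proj₂; uncurry)
open import Data.Sum using (inj₁; inj₂)
open import Data.Unit using (tt)
open import Function using (_∘_; id; Equivalence; _⇔_; mk⇔)
open import Function.Definitions using (Injective)
open import Relation.Binary.PropositionalEquality using (_≡_; _≢_; refl; cong; cong₂; subst; sym)
open import Relation.Nullary using (¬_; yes; no)
open import Relation.Nullary.Decidable using (T?; _×-dec_; ¬?; decidable-stable)

open Equivalence using (to; from)

count : ∀ {m} → (Fin m → Bool) → ℕ
count {zero}  P = 0
count {suc m} P = if P zero then suc (count (P ∘ suc)) else count (P ∘ suc)

count-mono : ∀ {m} {P Q : Fin m → Bool} →
             (∀ i → T (P i) → T (Q i)) → count P ≤ count Q
count-mono {zero}          P⇒Q = z≤n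
count-mono {suc m} {P} {Q} P⇒Q with P zero | Q zero | P⇒Q zero
... | true  | true  | _ = s≤s (count-mono (P⇒Q ∘ suc))
... | true  | false | f = ⊥-elim (f tt)
... | false | true  | _ = m≤n⇒m≤1+n (count-mono (P⇒Q ∘ suc))
... | false | false | _ = count-mono (P⇒Q ∘ suc)

count-mono-< : ∀ {m} {P Q : Fin m → Bool} → (∀ i → T (P i) → T (Q i)) →
               ∀ j → T (Q j) → ¬ T (P j) → count P < count Q
count-mono-< {suc m} {P} {Q} P⇒Q zero Qj ¬Pj with P zero | Q zero
... | true  | _     = ⊥-elim (¬Pj tt)
... | false | true  = s≤s (count-mono (P⇒Q ∘ suc))
count-mono-< {suc m} {P} {Q} P⇒Q (suc j) Qj ¬Pj with P zero | Q zero | P⇒Q zero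
... | true  | true  | _ = s≤s (count-mono-< (P⇒Q ∘ suc) j Qj ¬Pj)
... | true  | false | f = ⊥-elim (f tt)
... | false | true  | _ = m≤n⇒m≤1+n (count-mono-< (P⇒Q ∘ suc) j Qj ¬Pj)
... | false | false | _ = count-mono-< (P⇒Q ∘ suc) j Qj ¬Pj

rank : ∀ {m} (P : Fin m → Bool) (x : Fin m) → T (P x) → Fin (count P)
rank {suc m} P zero    Px with P zero
... | true  = zero
... | false = ⊥-elim Px
rank {suc m} P (suc x) Px with P zero
... | true  = suc (rank (P ∘ suc) x Px)
... | false = rank (P ∘ suc) x Px

rank-injective : ∀ {m} (P : Fin m → Bool) {x y} (Px : T (P x)) (Py : T (P y)) →
                 rank P x Px ≡ rank P y Py → x ≡ y
rank-injective {suc m} P {zero}  {zero}  Px Py eq = refl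
rank-injective {suc m} P {zero}  {suc y} Px Py eq with P zero
... | false = ⊥-elim Px
rank-injective {suc m} P {suc x} {zero}  Px Py eq with P zero
... | false = ⊥-elim Py
rank-injective {suc m} P {suc x} {suc y} Px Py eq with P zero
... | true  = cong suc (rank-injective (P ∘ suc) Px Py (suc-injective eq))
... | false = cong suc (rank-injective (P ∘ suc) Px Py eq)

Embedding : ∀ {m} → ℕ → (Fin m → Bool) → Set
Embedding {m} a P = Σ (Fin a → Fin m) λ f → Injective _≡_ _≡_ f × (∀ i → T (P (f i)))

enumerate : ∀ {m} (P : Fin m → Bool) → Embedding (count P) P
enumerate {zero}  P = (λ ()) , (λ { {()} }) , (λ ())
enumerate {suc m} P with P zero in P0 | enumerate (P ∘ suc)
... | true  | f , f-inj , f-ok = g , g-inj , g-ok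
  where
  g : Fin (suc (count (P ∘ suc))) → Fin (suc m)
  g zero    = zero
  g (suc i) = suc (f i)
  g-inj : Injective _≡_ _≡_ g
  g-inj {zero}  {zero}  _  = refl
  g-inj {suc i} {suc j} eq = cong suc (f-inj (suc-injective eq))
  g-ok : ∀ i → T (P (g i))
  g-ok zero    = subst T (sym P0) tt
  g-ok (suc i) = f-ok i
... | false | f , f-inj , f-ok = suc ∘ f , f-inj ∘ suc-injective , f-ok

embedding⇒≤count : ∀ {m a} (P : Fin m → Bool) → Embedding a P → a ≤ count P
embedding⇒≤count P (f , f-inj , f-ok) =
  injective⇒≤ (f-inj ∘ rank-injective P (f-ok _) (f-ok _))

≤count⇒embedding : ∀ {m a} (P : Fin m → Bool) → a ≤ count P → Embedding a P
≤count⇒embedding P a≤c with enumerate P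
... | f , f-inj , f-ok =
  (λ i → f (inject≤ i a≤c)) , inject≤-injective a≤c a≤c _ _ ∘ f-inj , (λ i → f-ok (inject≤ i a≤c))

commonNeighbours : ∀ {m} → Graph m → Fin m → Fin m → Fin m → Bool
commonNeighbours S u v w = S u w ∧ S v w

support : ∀ {m} → Graph m → Fin m → Fin m → ℕ
support S u v = count (commonNeighbours S u v)

support-comm : ∀ {m} (S : Graph m) u v → support S u v ≡ support S v u
support-comm S u v = ≤-antisym (count-mono (swap u v)) (count-mono (swap v u))
  where
  swap : ∀ u v w → T (commonNeighbours S u v w) → T (commonNeighbours S v u w)
  swap u v w = subst T (∧-comm (S u w) (S v w))

support-mono : ∀ {m} {S' S : Graph m} → S' ⊆ᴱ S → ∀ u v → support S' u v ≤ support S u v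
support-mono {S' = S'} S'⊆S u v = count-mono λ w common →
  let S'uw , S'vw = to (T-∧ {S' u w}) common in from T-∧ (S'⊆S u w S'uw , S'⊆S v w S'vw)

trussCond⇔support : ∀ {m k} {S : Graph m} →
                    TrussCond k S ⇔ (∀ u v → T (S u v) → k ∸ 2 ≤ support S u v)
trussCond⇔support {m} {k} {S} = mk⇔
  (λ tc u v Suv → embedding⇒≤count _ (fromTriangles (tc u v Suv)))
  (λ bound u v Suv → toTriangles (≤count⇒embedding _ (bound u v Suv)))
  where
  Triangles : Fin m → Fin m → Set
  Triangles u v = Σ (Fin (k ∸ 2) → Fin m) λ f →
    Injective _≡_ _≡_ f × (∀ i → T (S u (f i)) × T (S v (f i)))

  fromTriangles : ∀ {u v} → Triangles u v → Embedding (k ∸ 2) (commonNeighbours S u v)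
  fromTriangles (f , f-inj , f-ok) = f , f-inj , λ i → from T-∧ (f-ok i)

  toTriangles : ∀ {u v} → Embedding (k ∸ 2) (commonNeighbours S u v) → Triangles u v
  toTriangles (f , f-inj , f-ok) = f , f-inj , λ i → to T-∧ (f-ok i)

edgeCount : ∀ {m} → Graph m → ℕ
edgeCount {m} S = count (uncurry S ∘ remQuot m)

edgeCount-mono-< : ∀ {m} {S' S : Graph m} → S' ⊆ᴱ S →
                   ∀ u v → T (S u v) → ¬ T (S' u v) → edgeCount S' < edgeCount S
edgeCount-mono-< {S' = S'} {S} S'⊆S u v Suv ¬S'uv =
  count-mono-< (λ i → uncurry S'⊆S (remQuot _ i)) (combine u v)
    (subst (T ∘ uncurry S) (sym (remQuot-combine u v)) Suv)
    (¬S'uv ∘ subst (T ∘ uncurry S') (remQuot-combine u v))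

symmetricPart : ∀ {m} → Graph m → Graph m
symmetricPart H u v = H u v ∧ H v u

symmetricPart-symmetric : ∀ {m} (H : Graph m) → Symmetric (symmetricPart H)
symmetricPart-symmetric H u v = ∧-comm (H u v) (H v u)

symmetricPart-⊆ : ∀ {m} (H : Graph m) → symmetricPart H ⊆ᴱ H
symmetricPart-⊆ H u v = proj₁ ∘ to (T-∧ {H u v})

symmetric⇒⊆symmetricPart : ∀ {m} {S H : Graph m} → S ⊆ᴱ H → Symmetric S →
                           S ⊆ᴱ symmetricPart H
symmetric⇒⊆symmetricPart {S = S} S⊆H S-sym u v Suv =
  from T-∧ (S⊆H u v Suv , S⊆H v u (subst T (S-sym u v) Suv))

module _ {m : ℕ} (k : ℕ) where

  peel : Graph m → Graph m
  peel S u v = S u v ∧ (k ∸ 2 ≤ᵇ support S u v)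

  peel-⊆ : ∀ S → peel S ⊆ᴱ S
  peel-⊆ S u v = proj₁ ∘ to (T-∧ {S u v})

  peel-symmetric : ∀ {S} → Symmetric S → Symmetric (peel S)
  peel-symmetric {S} S-sym u v =
    cong₂ _∧_ (S-sym u v) (cong (k ∸ 2 ≤ᵇ_) (support-comm S u v))

  peel-stable⇒trussCond : ∀ {S} → S ⊆ᴱ peel S → TrussCond k S
  peel-stable⇒trussCond {S} stable = from (trussCond⇔support {k = k}) λ u v Suv →
    ≤ᵇ⇒≤ _ _ (proj₂ (to (T-∧ {S u v}) (stable u v Suv)))

  trussCond⇒⊆peel : ∀ {S' S} → S' ⊆ᴱ S → TrussCond k S' → S' ⊆ᴱ peel S
  trussCond⇒⊆peel S'⊆S tc u v S'uv = from T-∧ (S'⊆S u v S'uv ,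
    ≤⇒≤ᵇ (≤-trans (to (trussCond⇔support {k = k}) tc u v S'uv) (support-mono S'⊆S u v)))

  peel-stabilises : ∀ S → ∃ λ j → iterate peel S j ⊆ᴱ peel (iterate peel S j)
  peel-stabilises S = stabilisesWithin (suc (edgeCount S)) S ≤-refl
    where
    stabilisesWithin : ∀ N S → edgeCount S < N →
                       ∃ λ j → iterate peel S j ⊆ᴱ peel (iterate peel S j)
    stabilisesWithin (suc N) S count<N
      with any? (λ u → any? λ v → T? (S u v) ×-dec ¬? (T? (peel S u v)))
    ... | yes (u , v , Suv , ¬peeled) =
      let j , stable = stabilisesWithin N (peel S)
            (<-≤-trans (edgeCount-mono-< (peel-⊆ S) u v Suv ¬peeled) (s≤s⁻¹ count<N))
      in suc j , stable
    ... | no noneRemoved =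
      zero , λ u v Suv → decidable-stable (T? _) λ ¬peeled → noneRemoved (u , v , Suv , ¬peeled)

  iterate-peel-⊆ : ∀ S j → iterate peel S j ⊆ᴱ S
  iterate-peel-⊆ S zero    u v = id
  iterate-peel-⊆ S (suc j) u v = peel-⊆ S u v ∘ iterate-peel-⊆ (peel S) j u v

  iterate-peel-symmetric : ∀ {S} j → Symmetric S → Symmetric (iterate peel S j)
  iterate-peel-symmetric zero    S-sym = S-sym
  iterate-peel-symmetric (suc j) S-sym = iterate-peel-symmetric j (peel-symmetric S-sym)

  trussCond⇒⊆iterate-peel : ∀ {S' S} j → S' ⊆ᴱ S → TrussCond k S' → S' ⊆ᴱ iterate peel S j
  trussCond⇒⊆iterate-peel zero    S'⊆S tc = S'⊆S
  trussCond⇒⊆iterate-peel (suc j) S'⊆S tc =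
    trussCond⇒⊆iterate-peel j (trussCond⇒⊆peel S'⊆S tc) tc

  kTruss : (H : Graph m) → Σ (Graph m) (IsKTruss H k)
  kTruss H with peel-stabilises (symmetricPart H)
  ... | j , stable =
    iterate peel (symmetricPart H) j ,
    (λ u v → symmetricPart-⊆ H u v ∘ iterate-peel-⊆ (symmetricPart H) j u v) ,
    iterate-peel-symmetric j (symmetricPart-symmetric H) ,
    peel-stable⇒trussCond stable ,
    λ S S⊆H S-sym tc → trussCond⇒⊆iterate-peel j (symmetric⇒⊆symmetricPart S⊆H S-sym) tc

hasNonEmptyTruss-mono : ∀ {m k} {H H' : Graph m} → H ⊆ᴱ H' →
                        HasNonEmptyTruss H k → HasNonEmptyTruss H' k
hasNonEmptyTruss-mono {k = k} {H' = H'} H⊆H' (S , (S⊆H , S-sym , S-tc , _) , u , v , Suv)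
  with kTruss k H'
... | F , F-truss@(_ , _ , _ , F-largest) =
  F , F-truss , u , v , F-largest S (λ x y → H⊆H' x y ∘ S⊆H x y) S-sym S-tc u v Suv

∈-times⁺ : ∀ {ts te t} → ts ≤ t → t ≤ te → t ∈ times ts te
∈-times⁺ {ts} {te} ts≤t t≤te = subst (_∈ times ts te) (m+[n∸m]≡n ts≤t)
  (∈-applyUpTo⁺ (ts +_) (s≤s (∸-monoˡ-≤ ts t≤te)))

∈-times⁻ : ∀ {ts te t} → ts ≤ te → t ∈ times ts te → ts ≤ t × t ≤ te
∈-times⁻ {ts} ts≤te t∈times with ∈-applyUpTo⁻ (ts +_) t∈times
... | i , i≤te∸ts , refl =
  m≤m+n ts i , ≤-trans (+-monoʳ-≤ ts (s≤s⁻¹ i≤te∸ts)) (≤-reflexive (m+[n∸m]≡n ts≤te))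

times-⊆ : ∀ {ts te ts' te'} → (ts , te) ⊑ (ts' , te') → ts ≤ te → times ts te ⊆ times ts' te'
times-⊆ (ts'≤ts , te≤te') ts≤te t∈times =
  let ts≤t , t≤te = ∈-times⁻ ts≤te t∈times
  in ∈-times⁺ (≤-trans ts'≤ts ts≤t) (≤-trans t≤te te≤te')

snap-antitone : ∀ G {ts te ts' te'} → (ts , te) ⊑ (ts' , te') → ts ≤ te →
                snap G ts' te' ⊆ᴱ snap G ts te
snap-antitone G Δ⊑Δ' ts≤te u v = all-anti-mono (τ G u v) (times-⊆ Δ⊑Δ' ts≤te)

innermost-bounds : ∀ {m k j} {H H' : Graph m} → H ⊆ᴱ H' → IsInnermostOrder H' k → k < j →
                   ¬ HasNonEmptyTruss H j
innermost-bounds {j = j} H⊆H' (_ , _ , emptyAbove) k<j =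
  emptyAbove j k<j ∘ hasNonEmptyTruss-mono {k = j} H⊆H'

snap-innermost-bounds : ∀ G {ts te ts' te' k j} → ts ≤ te → (ts , te) ⊑ (ts' , te') →
                        IsInnermostOrder (snap G ts te) k → k < j →
                        ¬ HasNonEmptyTruss (snap G ts' te') j
snap-innermost-bounds G ts≤te Δ⊑Δ' = innermost-bounds (snap-antitone G Δ⊑Δ' ts≤te)

innermost⇒spanTruss : ∀ G {k ts te} → ValidInterval G ts te →
                      IsInnermostOrder (snap G ts te) k → IsSpanTruss G k ts te
innermost⇒spanTruss G valid (2≤k , nonEmpty , _) = 2≤k , valid , nonEmpty

maximal⇒extension-order< : ∀ G {k ts te k' ts' te'} → IsMaximalSpanTruss G k ts te →
                           ValidInterval G ts' te' → (ts , te) ⊑ (ts' , te') →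
                           (ts' , te') ≢ (ts , te) → IsInnermostOrder (snap G ts' te') k' → k' < k
maximal⇒extension-order< G {k' = k'} {ts'} {te'} (_ , maximal) valid' Δ⊑Δ' Δ'≢Δ inner' =
  ≰⇒> λ k≤k' → maximal k' ts' te' k≤k' Δ⊑Δ' (Δ'≢Δ ∘ cong {A = ℕ × ℕ × ℕ} proj₂)
                 (innermost⇒spanTruss G valid' inner')

extension-orders<⇒maximal : ∀ G {ts te k* k' k''} → ValidInterval G ts te →
                            IsInnermostOrder (snap G ts te) k* →
                            IsInnermostOrder (snap G (ts ∸ 1) te) k' →
                            IsInnermostOrder (snap G ts (suc te)) k'' →
                            k' < k* → k'' < k* → IsMaximalSpanTruss G k* ts te
extension-orders<⇒maximal G {ts} {te} {k*} valid@(ts≤te , _) inner inner' inner'' k'<k* k''<k* =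
  innermost⇒spanTruss G valid inner , noLarger
  where
  noLarger : ∀ k ts' te' → k* ≤ k → (ts , te) ⊑ (ts' , te') →
             (k , ts' , te') ≢ (k* , ts , te) → ¬ IsSpanTruss G k ts' te'
  noLarger k ts' te' k*≤k Δ⊑Δ'@(ts'≤ts , te≤te') Δ'≢Δ (_ , _ , nonEmpty)
    with m≤n⇒m<n∨m≡n ts'≤ts | m≤n⇒m<n∨m≡n te≤te'
  ... | inj₁ ts'<ts | _ =
    snap-innermost-bounds G (≤-trans (m∸n≤m ts 1) ts≤te) (∸-monoˡ-≤ 1 ts'<ts , te≤te') inner'
      (<-≤-trans k'<k* k*≤k) nonEmpty
  ... | inj₂ _ | inj₁ te<te' =
    snap-innermost-bounds G (m≤n⇒m≤1+n ts≤te) (ts'≤ts , te<te') inner''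
      (<-≤-trans k''<k* k*≤k) nonEmpty
  ... | inj₂ refl | inj₂ refl =
    snap-innermost-bounds G ts≤te Δ⊑Δ' inner
      (≤∧≢⇒< k*≤k λ k*≡k → Δ'≢Δ (cong (_, ts , te) (sym k*≡k))) nonEmpty

lemma3p6 : (G : TemporalGraph) (ts te k* k' k'' : ℕ) →
           1 ≤ ts → ts ≤ te → suc te ≤ tmax G →
           IsInnermostOrder (snap G ts te) k* →
           IsInnermostOrder (snap G (ts ∸ 1) te) k' →
           IsInnermostOrder (snap G ts (suc te)) k'' →
           (IsMaximalSpanTruss G k* ts te ⇔ (k' ⊔ k'' < k*))
lemma3p6 G ts te k* k' k'' 1≤ts ts≤te 1+te≤tmax inner inner' inner'' = mk⇔
  (λ maximal → ⊔-lub {k*} {suc k'} {suc k''}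
     (maximal⇒extension-order< G maximal valid' Δ⊑Δ' Δ'≢Δ inner')
     (maximal⇒extension-order< G maximal valid'' Δ⊑Δ'' Δ''≢Δ inner''))
  (λ k'⊔k''<k* → extension-orders<⇒maximal G (ts≤te , te≤tmax) inner inner' inner''
                   (m⊔n<o⇒m<o k' k'' k'⊔k''<k*) (m⊔n<o⇒n<o k' k'' k'⊔k''<k*))
  where
  te≤tmax : te ≤ tmax G
  te≤tmax = ≤-trans (n≤1+n te) 1+te≤tmax

  valid' : ValidInterval G (ts ∸ 1) te
  valid' = ≤-trans (m∸n≤m ts 1) ts≤te , te≤tmax

  valid'' : ValidInterval G ts (suc te)
  valid'' = m≤n⇒m≤1+n ts≤te , 1+te≤tmax

  Δ⊑Δ' : (ts , te) ⊑ (ts ∸ 1 , te)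
  Δ⊑Δ' = m∸n≤m ts 1 , ≤-refl

  Δ⊑Δ'' : (ts , te) ⊑ (ts , suc te)
  Δ⊑Δ'' = ≤-refl , n≤1+n te

  Δ'≢Δ : (ts ∸ 1 , te) ≢ (ts , te)
  Δ'≢Δ = <⇒≢ (∸-monoʳ-< z<s 1≤ts) ∘ cong proj₁

  Δ''≢Δ : (ts , suc te) ≢ (ts , te)
  Δ''≢Δ = 1+n≢n ∘ cong proj₂
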